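{- Let $q\geq 2$, $n$, $t$, $k$ be integers with $1\leq t<n$ and $1\leq k\leq\min\{n-1,2t\}$. For $1\leq i\leq t$ let $k_i=(k-iq)\bmod n$ and $$C_{k,i}:=q-\left\lceil\frac{k}{t}\right\rceil+\left\lceil\frac{k_i}{t}\right\rceil+\left\lceil\frac{iq-k}{n}\right\rceil,$$ and let $M_k$ denote the minimum of the set consisting of $q$ together with $C_{k,i}$ for $1\leq i\leq t$. (a) If $1\leq k\leq t$, then $M_k=q-1$ if $q\mid k$, and $M_k=q$ otherwise. (b) If $t<k\leq\min\{n-1,2t\}$, then: $M_k=q-2$ if $q\mid k$; $M_k=q-1$ if $q\nmid k$ and $t\geq (k\bmod q)$; $M_k=q-1$ if $q\nmid k$, $q\mid (k+n)$ and $k\leq qt-n$; and $M_k=q$ in all other cases.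
   Context: For integers $a$ and $b\geq1$, $a\bmod b$ denotes the remainder in $\{0,\dots,b-1\}$. -}

module Defs where

open import Data.Nat as ℕ using (ℕ; zero; suc)
import Data.Nat.DivMod as ℕD
open import Data.Integer as ℤ using (ℤ; +_; -_; _-_; _+_; _*_; _⊓_; _/ℕ_; _%ℕ_)

-- The value for d = 0 is an irrelevant junk value (never used: d ≥ 1 in the statement).
ceilDiv : ℤ → ℕ → ℤ
ceilDiv a zero    = + 0
ceilDiv a (suc d) = - ((- a) /ℕ suc d)

-- a mod b ∈ {0, …, b-1} for an integer a and a natural b ≥ 1 (junk for b = 0).
modℤ : ℤ → ℕ → ℕ
modℤ a zero    = 0
modℤ a (suc b) = a %ℕ suc b

-- k mod q for naturals (junk for q = 0)
modℕ : ℕ → ℕ → ℕ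
modℕ k zero    = k
modℕ k (suc q) = k ℕD.% suc q

kᵢ : (q n k i : ℕ) → ℕ
kᵢ q n k i = modℤ (+ k - + (i ℕ.* q)) n

C : (q n t k i : ℕ) → ℤ
C q n t k i = + q - ceilDiv (+ k) t + ceilDiv (+ kᵢ q n k i) t
              + ceilDiv (+ (i ℕ.* q) - + k) n

minUpTo : (q n t k m : ℕ) → ℤ
minUpTo q n t k zero    = + q
minUpTo q n t k (suc m) = minUpTo q n t k m ⊓ C q n t k (suc m)

M : (q n t k : ℕ) → ℤ
M q n t k = minUpTo q n t k t

-- Write p = i q. Because k < n, the two ceilings ⌈k_i/t⌉ + ⌈(iq - k)/n⌉ in C_{k,i} combine
-- into an excess E(p) = ⌈(k + w n - p)/t⌉ + w, where w = ⌈(p - k)/n⌉ is the number of times n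
-- has to be added to k to reach p; so C_{k,i} = q - ⌈k/t⌉ + E(iq). Now E(p) = 0 only for p = k,
-- E(p) = 1 only for k - t ≤ p < k or p = k + n, and E(p) ≥ 2 otherwise. Since ⌈k/t⌉ is 1 in
-- case (a) and 2 in case (b), M_k = q - ⌈k/t⌉ + min (⌈k/t⌉, E(q), …, E(tq)), and each case of
-- the proposition says which of these situations is realised by a multiple iq with 1 ≤ i ≤ t
-- (for k - t ≤ iq < k this happens exactly when k mod q ≤ t).

module Submission where

open import Algebra.Bundles using (AbelianGroup)
open import Data.Integer as ℤ using (ℤ; +_; -_; _-_; _/ℕ_; _%ℕ_)
open import Data.Integer.DivMod using (a≡a%ℕn+[a/ℕn]*n; [n/ℕd]*d≤n; n<s[n/ℕd]*d)
import Data.Integer.Properties as ℤ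
open import Data.Integer.Tactic.RingSolver using (solve-∀)
open import Data.Nat as ℕ using (ℕ; zero; suc; pred; NonZero; z≤n; s≤s; s≤s⁻¹; _≤_; _<_; _+_; _*_; _∸_; _⊓_)
open import Data.Nat.DivMod using (m≡m%n+[m/n]*n; m%n<n; m%n≤m; m/n*n≤m; m<n*o⇒m/o<n; m*n≤o⇒[o∸m*n]%n≡o%n)
open import Data.Nat.Divisibility using (_∣_; divides; m%n≡0⇒n∣m)
open import Data.Nat.Properties
open import Data.Product using (_×_; Σ-syntax; _,_; proj₁; proj₂)
open import Data.Sum using (_⊎_; inj₁; inj₂; map₁)
open import Relation.Binary.Definitions using (tri<; tri≈; tri>)
open import Relation.Binary.PropositionalEquality using (_≡_; _≢_; refl; sym; trans; cong; cong₂; subst; subst₂; module ≡-Reasoning)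
open import Relation.Nullary using (¬_; yes; no; contradiction)

open import Defs
open import Algebra.Properties.Group (AbelianGroup.group ℤ.+-0-abelianGroup) using (∙-cancelʳ)

⌈_/_⌉ : ℕ → (d : ℕ) .{{_ : NonZero d}} → ℕ
⌈ a / d ⌉ = (a + pred d) ℕ./ d

module _ (a d : ℕ) .{{_ : NonZero d}} where

  private
    pred[d]<d : pred d < d
    pred[d]<d = ≤-reflexive (suc-pred d)

  ≤⌈/⌉* : a ≤ ⌈ a / d ⌉ * d
  ≤⌈/⌉* = +-cancelʳ-≤ (pred d) a _ (begin
    a + pred d                                   ≡⟨ m≡m%n+[m/n]*n (a + pred d) d ⟩
    (a + pred d) ℕ.% d + ⌈ a / d ⌉ * d           ≤⟨ +-monoˡ-≤ _ (<⇒≤pred (m%n<n (a + pred d) d)) ⟩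
    pred d + ⌈ a / d ⌉ * d                       ≡⟨ +-comm (pred d) _ ⟩
    ⌈ a / d ⌉ * d + pred d                       ∎)
    where open ≤-Reasoning

  ⌈/⌉*<+ : ⌈ a / d ⌉ * d < a + d
  ⌈/⌉*<+ = begin-strict
    ⌈ a / d ⌉ * d   ≤⟨ m/n*n≤m (a + pred d) d ⟩
    a + pred d      <⟨ +-monoʳ-< a pred[d]<d ⟩
    a + d           ∎
    where open ≤-Reasoning

  ⌈/⌉-least : ∀ m → a ≤ m * d → ⌈ a / d ⌉ ≤ m
  ⌈/⌉-least m a≤m*d = s≤s⁻¹ (m<n*o⇒m/o<n (begin-strict
    a + pred d   <⟨ +-mono-≤-< a≤m*d pred[d]<d ⟩
    m * d + d    ≡⟨ +-comm (m * d) d ⟩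
    suc m * d    ∎))
    where open ≤-Reasoning

  ⌈/⌉-greatest : ∀ m → m * d < a → m < ⌈ a / d ⌉
  ⌈/⌉-greatest m m*d<a = *-cancelʳ-< d m _ (<-≤-trans m*d<a ≤⌈/⌉*)

⌈0/d⌉≡0 : ∀ d .{{_ : NonZero d}} → ⌈ 0 / d ⌉ ≡ 0
⌈0/d⌉≡0 d = n≤0⇒n≡0 (⌈/⌉-least 0 d 0 z≤n)

0<⌈/⌉ : ∀ {a} d .{{_ : NonZero d}} → 0 < a → 0 < ⌈ a / d ⌉
0<⌈/⌉ {a} d = ⌈/⌉-greatest a d 0

1<⌈/⌉ : ∀ {a} d .{{_ : NonZero d}} → d < a → 1 < ⌈ a / d ⌉
1<⌈/⌉ {a} d d<a = ⌈/⌉-greatest a d 1 (subst (_< a) (sym (*-identityˡ d)) d<a)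

⌈/⌉≡1 : ∀ {a} d .{{_ : NonZero d}} → 0 < a → a ≤ d → ⌈ a / d ⌉ ≡ 1
⌈/⌉≡1 {a} d 0<a a≤d = ≤-antisym (⌈/⌉-least a d 1 (subst (a ≤_) (sym (*-identityˡ d)) a≤d)) (0<⌈/⌉ d 0<a)

⌈/⌉≡2 : ∀ {a} d .{{_ : NonZero d}} → d < a → a ≤ 2 * d → ⌈ a / d ⌉ ≡ 2
⌈/⌉≡2 {a} d d<a a≤2d = ≤-antisym (⌈/⌉-least a d 2 a≤2d) (1<⌈/⌉ d d<a)

/ℕ-%ℕ-unique : ∀ x d .{{_ : NonZero d}} r q → r < d → x ≡ + r ℤ.+ q ℤ.* + d →
               x /ℕ d ≡ q × x %ℕ d ≡ r
/ℕ-%ℕ-unique x d r q r<d x≡r+q*d = x/d≡q , ℤ.+-injective (∙-cancelʳ (q ℤ.* + d) _ _ (begin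
    + (x %ℕ d) ℤ.+ q ℤ.* + d         ≡⟨ cong (λ y → + (x %ℕ d) ℤ.+ y ℤ.* + d) x/d≡q ⟨
    + (x %ℕ d) ℤ.+ x /ℕ d ℤ.* + d    ≡⟨ a≡a%ℕn+[a/ℕn]*n x d ⟨
    x                                ≡⟨ x≡r+q*d ⟩
    + r ℤ.+ q ℤ.* + d                ∎))
  where
  open ≡-Reasoning
  below : ∀ {i j} → i ℤ.* + d ℤ.< ℤ.suc j ℤ.* + d → i ℤ.≤ j
  below {i} {j} lt =
    subst (i ℤ.≤_) (ℤ.pred-suc j) (ℤ.i<j⇒i≤pred[j] {j = ℤ.suc j} (ℤ.*-cancelʳ-<-nonNeg (+ d) lt))
  q*d≤x : q ℤ.* + d ℤ.≤ x
  q*d≤x = subst (q ℤ.* + d ℤ.≤_) (sym x≡r+q*d) (ℤ.i≤j+i _ (+ r))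
  x<[1+q]*d : x ℤ.< ℤ.suc q ℤ.* + d
  x<[1+q]*d =
    subst₂ ℤ._<_ (sym x≡r+q*d) (sym (ℤ.suc-* q (+ d))) (ℤ.+-monoˡ-< (q ℤ.* + d) (ℤ.+<+ r<d))
  x/d≡q : x /ℕ d ≡ q
  x/d≡q = ℤ.≤-antisym (below (ℤ.≤-<-trans ([n/ℕd]*d≤n x d) x<[1+q]*d))
                      (below (ℤ.≤-<-trans q*d≤x (n<s[n/ℕd]*d x d)))

+[m∸n]≡+m-+n : ∀ {m n} → n ≤ m → + (m ∸ n) ≡ + m - + n
+[m∸n]≡+m-+n {m} {n} n≤m = sym (trans (ℤ.m-n≡m⊖n m n) (ℤ.⊖-≥ n≤m))

/ℕ-%ℕ-difference : ∀ k p w n .{{_ : NonZero n}} → p ≤ k + w * n → k + w * n < p + n →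
                   (+ k - + p) /ℕ n ≡ - + w × (+ k - + p) %ℕ n ≡ k + w * n ∸ p
/ℕ-%ℕ-difference k p w n p≤k+wn k+wn<p+n =
  /ℕ-%ℕ-unique _ n _ (- + w) (m<n+o⇒m∸n<o (k + w * n) p k+wn<p+n) (begin
    + k - + p                                       ≡⟨ shift (+ k) (+ p) (+ w) (+ n) ⟩
    + k ℤ.+ + w ℤ.* + n - + p ℤ.+ - + w ℤ.* + n    ≡⟨ cong (λ x → x - + p ℤ.+ - + w ℤ.* + n) +[k+wn] ⟨
    + (k + w * n) - + p ℤ.+ - + w ℤ.* + n          ≡⟨ cong (ℤ._+ - + w ℤ.* + n) (+[m∸n]≡+m-+n p≤k+wn) ⟨
    + (k + w * n ∸ p) ℤ.+ - + w ℤ.* + n            ∎)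
  where
  open ≡-Reasoning
  shift : ∀ a b c d → a - b ≡ a ℤ.+ c ℤ.* d - b ℤ.+ - c ℤ.* d
  shift = solve-∀
  +[k+wn] : + (k + w * n) ≡ + k ℤ.+ + w ℤ.* + n
  +[k+wn] = trans (ℤ.pos-+ k (w * n)) (cong (λ x → + k ℤ.+ x) (ℤ.pos-* w n))

ceilDiv≡⌈/⌉ : ∀ a d → ceilDiv (+ a) (suc d) ≡ + ⌈ a / suc d ⌉
ceilDiv≡⌈/⌉ a d = begin
  - ((- + a) /ℕ suc d)          ≡⟨ cong (λ x → - (x /ℕ suc d)) (ℤ.+-identityˡ (- + a)) ⟨
  - ((+ 0 - + a) /ℕ suc d)      ≡⟨ cong -_ (proj₁ (/ℕ-%ℕ-difference 0 a c (suc d) a≤c*d c*d<a+d)) ⟩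
  - - + c                       ≡⟨ ℤ.neg-involutive (+ c) ⟩
  + c                           ∎
  where
  open ≡-Reasoning
  c : ℕ
  c = ⌈ a / suc d ⌉
  a≤c*d : a ≤ c * suc d
  a≤c*d = ≤⌈/⌉* a (suc d)
  c*d<a+d : c * suc d < a + suc d
  c*d<a+d = ⌈/⌉*<+ a (suc d)

m+n<o⇒n<o∸m : ∀ m {n o} → m + n < o → n < o ∸ m
m+n<o⇒n<o∸m m {n} {o} m+n<o = m+n≤o⇒m≤o∸n (suc n) (subst (_≤ o) (cong suc (+-comm m n)) m+n<o)

wraps : (n k p : ℕ) .{{_ : NonZero n}} → ℕ
wraps n k p = ⌈ p ∸ k / n ⌉

excess : (n t k p : ℕ) .{{_ : NonZero n}} .{{_ : NonZero t}} → ℕ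
excess n t k p = ⌈ k + wraps n k p * n ∸ p / t ⌉ + wraps n k p

module _ {n k p : ℕ} .{{_ : NonZero n}} where

  wraps-≤ : p ≤ k → wraps n k p ≡ 0
  wraps-≤ p≤k = trans (cong (λ a → ⌈ a / n ⌉) (m≤n⇒m∸n≡0 p≤k)) (⌈0/d⌉≡0 n)

  wraps≡1 : k < p → p ≤ k + n → wraps n k p ≡ 1
  wraps≡1 k<p p≤k+n = ⌈/⌉≡1 n (m<n⇒0<n∸m k<p) (m≤n+o⇒m∸n≤o p k p≤k+n)

  1<wraps : k + n < p → 1 < wraps n k p
  1<wraps k+n<p = 1<⌈/⌉ n (m+n<o⇒n<o∸m k k+n<p)

  wraps-bounds : k < n → p ≤ k + wraps n k p * n × k + wraps n k p * n < p + n
  wraps-bounds k<n = ≤-trans (m≤n+m∸n p k) (+-monoʳ-≤ k (≤⌈/⌉* (p ∸ k) n)) , upper (≤-total p k)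
    where
    open ≤-Reasoning
    upper : p ≤ k ⊎ k ≤ p → k + wraps n k p * n < p + n
    upper (inj₁ p≤k) = begin-strict
      k + wraps n k p * n   ≡⟨ cong (λ w → k + w * n) (wraps-≤ p≤k) ⟩
      k + 0                 ≡⟨ +-identityʳ k ⟩
      k                     <⟨ k<n ⟩
      n                     ≤⟨ m≤n+m n p ⟩
      p + n                 ∎
    upper (inj₂ k≤p) = begin-strict
      k + wraps n k p * n   <⟨ +-monoʳ-< k (⌈/⌉*<+ (p ∸ k) n) ⟩
      k + (p ∸ k + n)       ≡⟨ +-assoc k (p ∸ k) n ⟨
      k + (p ∸ k) + n       ≡⟨ cong (_+ n) (m+[n∸m]≡n k≤p) ⟩
      p + n                 ∎

module _ {n t k p : ℕ} .{{_ : NonZero n}} .{{_ : NonZero t}} where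

  excess≡ : ∀ {w} → wraps n k p ≡ w → excess n t k p ≡ ⌈ k + w * n ∸ p / t ⌉ + w
  excess≡ refl = refl

  excess-≤ : p ≤ k → excess n t k p ≡ ⌈ k ∸ p / t ⌉
  excess-≤ p≤k = trans (excess≡ (wraps-≤ p≤k))
                       (trans (+-identityʳ _) (cong (λ a → ⌈ a ∸ p / t ⌉) (+-identityʳ k)))

  excess-self : p ≡ k → excess n t k p ≡ 0
  excess-self refl = trans (excess-≤ ≤-refl) (trans (cong (λ a → ⌈ a / t ⌉) (n∸n≡0 k)) (⌈0/d⌉≡0 t))

  excess-near : p < k → k ≤ p + t → excess n t k p ≡ 1
  excess-near p<k k≤p+t = trans (excess-≤ (<⇒≤ p<k)) (⌈/⌉≡1 t (m<n⇒0<n∸m p<k) (m≤n+o⇒m∸n≤o k p k≤p+t))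

  excess-wrap : p ≡ k + n → excess n t k p ≡ 1
  excess-wrap refl = trans (excess≡ (wraps≡1 (m<m+n k (ℕ.>-nonZero⁻¹ n)) ≤-refl))
                           (cong (_+ 1) (trans (cong (λ a → ⌈ a / t ⌉) k+1*n∸[k+n]≡0) (⌈0/d⌉≡0 t)))
    where
    k+1*n∸[k+n]≡0 : k + 1 * n ∸ (k + n) ≡ 0
    k+1*n∸[k+n]≡0 = m≤n⇒m∸n≡0 (≤-reflexive (cong (λ x → k + x) (*-identityˡ n)))

  excess-pos : p ≢ k → 1 ≤ excess n t k p
  excess-pos p≢k with <-cmp p k
  ... | tri< p<k _ _ = subst (1 ≤_) (sym (excess-≤ (<⇒≤ p<k))) (0<⌈/⌉ t (m<n⇒0<n∸m p<k))
  ... | tri≈ _ p≡k _ = contradiction p≡k p≢k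
  ... | tri> _ _ k<p = ≤-trans (0<⌈/⌉ {p ∸ k} n (m<n⇒0<n∸m k<p)) (m≤n+m (wraps n k p) _)

  excess≥2 : p ≢ k → ¬ (p < k × k ≤ p + t) → p ≢ k + n → 2 ≤ excess n t k p
  excess≥2 p≢k not-near p≢k+n with <-cmp p k
  ... | tri< p<k _ _ = subst (2 ≤_) (sym (excess-≤ (<⇒≤ p<k)))
                         (1<⌈/⌉ t (m+n<o⇒n<o∸m p (≰⇒> (λ k≤p+t → not-near (p<k , k≤p+t)))))
  ... | tri≈ _ p≡k _ = contradiction p≡k p≢k
  ... | tri> _ _ k<p with <-cmp p (k + n)
  ...   | tri< p<k+n _ _ = subst (2 ≤_) (sym (excess≡ (wraps≡1 k<p (<⇒≤ p<k+n))))
                             (+-monoˡ-≤ 1 (0<⌈/⌉ t (m<n⇒0<n∸m p<k+1*n)))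
    where
    p<k+1*n : p < k + 1 * n
    p<k+1*n = subst (p <_) (cong (λ x → k + x) (sym (*-identityˡ n))) p<k+n
  ...   | tri≈ _ p≡k+n _ = contradiction p≡k+n p≢k+n
  ...   | tri> _ _ k+n<p = ≤-trans (1<wraps k+n<p) (m≤n+m (wraps n k p) _)

C≡q∸⌈k/t⌉+excess : ∀ q n t k i → k < suc n → ⌈ k / suc t ⌉ ≤ q →
                   C q (suc n) (suc t) k i ≡ + (q ∸ ⌈ k / suc t ⌉ + excess (suc n) (suc t) k (i * q))
C≡q∸⌈k/t⌉+excess q n t k i k<n c≤q = begin
    + q - ceilDiv (+ k) T ℤ.+ ceilDiv (+ kᵢ q N k i) T ℤ.+ ceilDiv (+ p - + k) N
  ≡⟨ ℤ.+-assoc (+ q - ceilDiv (+ k) T) _ _ ⟩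
    + q - ceilDiv (+ k) T ℤ.+ (ceilDiv (+ kᵢ q N k i) T ℤ.+ ceilDiv (+ p - + k) N)
  ≡⟨ cong₂ ℤ._+_ q-⌈k/t⌉ (cong₂ ℤ._+_ ceil[kᵢ] ceil[p-k]) ⟩
    + (q ∸ ⌈ k / T ⌉) ℤ.+ (+ ⌈ k + w * N ∸ p / T ⌉ ℤ.+ + w)
  ≡⟨ cong (λ x → + (q ∸ ⌈ k / T ⌉) ℤ.+ x) (ℤ.pos-+ ⌈ k + w * N ∸ p / T ⌉ w) ⟨
    + (q ∸ ⌈ k / T ⌉) ℤ.+ + excess N T k p
  ≡⟨ ℤ.pos-+ (q ∸ ⌈ k / T ⌉) (excess N T k p) ⟨
    + (q ∸ ⌈ k / T ⌉ + excess N T k p)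
  ∎
  where
  open ≡-Reasoning
  N T p w : ℕ
  N = suc n
  T = suc t
  p = i * q
  w = wraps N k p
  q-⌈k/t⌉ : + q - ceilDiv (+ k) T ≡ + (q ∸ ⌈ k / T ⌉)
  q-⌈k/t⌉ = trans (cong (λ x → + q - x) (ceilDiv≡⌈/⌉ k t)) (sym (+[m∸n]≡+m-+n c≤q))
  divMod : (+ k - + p) /ℕ N ≡ - + w × (+ k - + p) %ℕ N ≡ k + w * N ∸ p
  divMod = /ℕ-%ℕ-difference k p w N (proj₁ (wraps-bounds k<n)) (proj₂ (wraps-bounds k<n))
  ceil[kᵢ] : ceilDiv (+ kᵢ q N k i) T ≡ + ⌈ k + w * N ∸ p / T ⌉
  ceil[kᵢ] = trans (cong (λ r → ceilDiv (+ r) T) (proj₂ divMod)) (ceilDiv≡⌈/⌉ (k + w * N ∸ p) t)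
  negate : ∀ a b → - (a - b) ≡ b - a
  negate = solve-∀
  ceil[p-k] : ceilDiv (+ p - + k) N ≡ + w
  ceil[p-k] = begin
    - ((- (+ p - + k)) /ℕ N)   ≡⟨ cong (λ x → - (x /ℕ N)) (negate (+ p) (+ k)) ⟩
    - ((+ k - + p) /ℕ N)       ≡⟨ cong -_ (proj₁ divMod) ⟩
    - - + w                    ≡⟨ ℤ.neg-involutive (+ w) ⟩
    + w                        ∎

module _ (q n t k : ℕ) where

  minUpTo≤q : ∀ m → minUpTo q n t k m ℤ.≤ + q
  minUpTo≤q zero    = ℤ.≤-refl
  minUpTo≤q (suc m) = ℤ.≤-trans (ℤ.i⊓j≤i _ _) (minUpTo≤q m)

  minUpTo≤C : ∀ {m i} → 1 ≤ i → i ≤ m → minUpTo q n t k m ℤ.≤ C q n t k i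
  minUpTo≤C {zero}  (s≤s _) ()
  minUpTo≤C {suc m} {i} 1≤i i≤1+m with i ℕ.≟ suc m
  ... | yes refl = ℤ.i⊓j≤j _ _
  ... | no i≢1+m = ℤ.≤-trans (ℤ.i⊓j≤i _ _) (minUpTo≤C 1≤i (s≤s⁻¹ (≤∧≢⇒< i≤1+m i≢1+m)))

  ≤minUpTo : ∀ m {v} → v ℤ.≤ + q → (∀ i → 1 ≤ i → i ≤ m → v ℤ.≤ C q n t k i) → v ℤ.≤ minUpTo q n t k m
  ≤minUpTo zero    v≤q v≤C = v≤q
  ≤minUpTo (suc m) v≤q v≤C = ℤ.⊓-glb (≤minUpTo m v≤q (λ i 1≤i i≤m → v≤C i 1≤i (m≤n⇒m≤1+n i≤m)))
                                     (v≤C (suc m) (s≤s z≤n) ≤-refl)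

m∸[n∸o]≡m∸n+o : ∀ {m n o} → o ≤ n → n ≤ m → m ∸ (n ∸ o) ≡ m ∸ n + o
m∸[n∸o]≡m∸n+o {m} {n} {o} o≤n n≤m = begin
  m ∸ (n ∸ o)                       ≡⟨ cong (_∸ (n ∸ o)) m≡ ⟨
  m ∸ n + o + (n ∸ o) ∸ (n ∸ o)     ≡⟨ m+n∸n≡m (m ∸ n + o) (n ∸ o) ⟩
  m ∸ n + o                         ∎
  where
  open ≡-Reasoning
  m≡ : m ∸ n + o + (n ∸ o) ≡ m
  m≡ = trans (+-assoc (m ∸ n) o (n ∸ o)) (trans (cong (λ x → m ∸ n + x) (m+[n∸m]≡n o≤n)) (m∸n+n≡m n≤m))

Attains : (q n t k e : ℕ) → Set
Attains q n t k e = Σ[ i ∈ ℕ ] (1 ≤ i × i ≤ suc t × excess (suc n) (suc t) k (i * q) ≡ e)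

M≡q∸[c∸e] : ∀ {q n t k} c e → k < suc n → ⌈ k / suc t ⌉ ≡ c → c ≤ q → e ≤ c →
  (∀ i → 1 ≤ i → i ≤ suc t → e ≤ excess (suc n) (suc t) k (i * q)) →
  e ≡ c ⊎ Attains q n t k e → M q (suc n) (suc t) k ≡ + (q ∸ (c ∸ e))
M≡q∸[c∸e] {q} {n} {t} {k} c e k<n c≡ c≤q e≤c e≤excess attained =
  ℤ.≤-antisym (upper attained) (≤minUpTo q N T k T (ℤ.+≤+ (m∸n≤m q (c ∸ e))) lower)
  where
  N T : ℕ
  N = suc n
  T = suc t
  v≡ : q ∸ (c ∸ e) ≡ q ∸ c + e
  v≡ = m∸[n∸o]≡m∸n+o e≤c c≤q
  C≡ : ∀ i → C q N T k i ≡ + (q ∸ c + excess N T k (i * q))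
  C≡ i = trans (C≡q∸⌈k/t⌉+excess q n t k i k<n (subst (_≤ q) (sym c≡) c≤q))
               (cong (λ x → + (q ∸ x + excess N T k (i * q))) c≡)
  lower : ∀ i → 1 ≤ i → i ≤ T → + (q ∸ (c ∸ e)) ℤ.≤ C q N T k i
  lower i 1≤i i≤T = subst₂ ℤ._≤_ (cong +_ (sym v≡)) (sym (C≡ i))
                           (ℤ.+≤+ (+-monoʳ-≤ (q ∸ c) (e≤excess i 1≤i i≤T)))
  upper : e ≡ c ⊎ Attains q n t k e → M q N T k ℤ.≤ + (q ∸ (c ∸ e))
  upper (inj₁ refl) = subst (λ x → M q N T k ℤ.≤ + (q ∸ x)) (sym (n∸n≡0 e)) (minUpTo≤q q N T k T)
  upper (inj₂ (i , 1≤i , i≤T , excess≡e)) =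
    ℤ.≤-trans (minUpTo≤C q N T k 1≤i i≤T)
              (ℤ.≤-reflexive (trans (C≡ i) (cong +_ (trans (cong (λ x → q ∸ c + x) excess≡e) (sym v≡)))))

module _ {q : ℕ} .{{_ : NonZero q}} where

  quotient-near : ∀ {k t} → ¬ q ∣ k → k ℕ.% q ≤ t → t < k →
                  1 ≤ k ℕ./ q × k ℕ./ q * q < k × k ≤ k ℕ./ q * q + t
  quotient-near {k} {t} q∤k r≤t t<k = 1≤i , iq<k , k≤iq+t
    where
    i : ℕ
    i = k ℕ./ q
    k≡r+iq : k ≡ k ℕ.% q + i * q
    k≡r+iq = m≡m%n+[m/n]*n k q
    iq<k : i * q < k
    iq<k = subst (i * q <_) (sym k≡r+iq)
                 (m<n+m (i * q) (n≢0⇒n>0 (λ r≡0 → q∤k (m%n≡0⇒n∣m k q r≡0))))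
    k≤iq+t : k ≤ i * q + t
    k≤iq+t = subst₂ _≤_ (sym k≡r+iq) (+-comm t (i * q)) (+-monoˡ-≤ (i * q) r≤t)
    1≤i : 1 ≤ i
    1≤i = n≢0⇒n>0 (λ i≡0 → <⇒≱ t<k (subst (λ j → k ≤ j * q + t) i≡0 k≤iq+t))

  %-near : ∀ {i k t} → i * q < k → k ≤ i * q + t → k ℕ.% q ≤ t
  %-near {i} {k} {t} iq<k k≤iq+t = begin
    k ℕ.% q               ≡⟨ m*n≤o⇒[o∸m*n]%n≡o%n i (<⇒≤ iq<k) ⟨
    (k ∸ i * q) ℕ.% q     ≤⟨ m%n≤m (k ∸ i * q) q ⟩
    k ∸ i * q             ≤⟨ m≤n+o⇒m∸n≤o k (i * q) k≤iq+t ⟩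
    t                     ∎
    where open ≤-Reasoning

1≤quotient : ∀ {i k q} → 1 ≤ k → k ≡ i * q → 1 ≤ i
1≤quotient {zero}  () refl
1≤quotient {suc i} _  _    = s≤s z≤n

module Cases {q n t k c : ℕ} .{{_ : NonZero q}}
             (k<n : k < suc n) (1≤k : 1 ≤ k) (c≡ : ⌈ k / suc t ⌉ ≡ c) (c≤q : c ≤ q) where

  quotient≤t : ∀ {i} → i * q ≤ k → i ≤ suc t
  quotient≤t {i} iq≤k = *-cancelʳ-≤ i (suc t) q (begin
    i * q                   ≤⟨ iq≤k ⟩
    k                       ≤⟨ ≤⌈/⌉* k (suc t) ⟩
    ⌈ k / suc t ⌉ * suc t   ≡⟨ cong (_* suc t) c≡ ⟩
    c * suc t               ≤⟨ *-monoˡ-≤ (suc t) c≤q ⟩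
    q * suc t               ≡⟨ *-comm q (suc t) ⟩
    suc t * q               ∎)
    where open ≤-Reasoning

  -- The implicit {n = suc n} given to the excess lemmas below keeps instance search from
  -- resolving their NonZero n argument with the NonZero q instance of this module.

  iq≢k : ¬ q ∣ k → ∀ i → i * q ≢ k
  iq≢k q∤k i iq≡k = q∤k (divides i (sym iq≡k))

  M-multiple : q ∣ k → M q (suc n) (suc t) k ≡ + (q ∸ c)
  M-multiple (divides i k≡iq) = M≡q∸[c∸e] c 0 k<n c≡ c≤q z≤n (λ _ _ _ → z≤n)
    (inj₂ (i , 1≤quotient 1≤k k≡iq , quotient≤t (≤-reflexive (sym k≡iq)) , excess-self {n = suc n} (sym k≡iq)))

  M-non-multiple : ¬ q ∣ k → 1 ≤ c → c ≡ 1 ⊎ Attains q n t k 1 → M q (suc n) (suc t) k ≡ + (q ∸ (c ∸ 1))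
  M-non-multiple q∤k 1≤c attained =
    M≡q∸[c∸e] c 1 k<n c≡ c≤q 1≤c (λ i _ _ → excess-pos {n = suc n} (iq≢k q∤k i)) (map₁ sym attained)

  near-multiple : ¬ q ∣ k → k ℕ.% q ≤ suc t → suc t < k → Attains q n t k 1
  near-multiple q∤k r≤t t<k with quotient-near q∤k r≤t t<k
  ... | 1≤i , iq<k , k≤iq+t = k ℕ./ q , 1≤i , quotient≤t (<⇒≤ iq<k) , excess-near {n = suc n} iq<k k≤iq+t

  wrap-multiple : q ∣ k + suc n → k ≤ q * suc t ∸ suc n → Attains q n t k 1
  wrap-multiple (divides j k+n≡jq) k≤qt∸n =
    j , 1≤quotient (≤-trans 1≤k (m≤m+n k (suc n))) k+n≡jq , j≤t , excess-wrap {n = suc n} (sym k+n≡jq)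
    where
    n<qt : suc n < q * suc t
    n<qt = m∸n≢0⇒n<m (λ qt∸n≡0 → <⇒≱ 1≤k (subst (k ≤_) qt∸n≡0 k≤qt∸n))
    j≤t : j ≤ suc t
    j≤t = *-cancelʳ-≤ j (suc t) q (subst₂ _≤_ k+n≡jq (*-comm q (suc t)) (m≤o∸n⇒m+n≤o k (<⇒≤ n<qt) k≤qt∸n))

  M-far : ¬ q ∣ k → ¬ (k ℕ.% q ≤ suc t) → ¬ (q ∣ k + suc n × k ≤ q * suc t ∸ suc n) → c ≡ 2 →
          M q (suc n) (suc t) k ≡ + q
  M-far q∤k r>t not-wrap refl = M≡q∸[c∸e] 2 2 k<n c≡ c≤q ≤-refl
    (λ i _ i≤t → excess≥2 {n = suc n} (iq≢k q∤k i) (not-near i) (iq≢k+n i i≤t)) (inj₁ refl)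
    where
    not-near : ∀ i → ¬ (i * q < k × k ≤ i * q + suc t)
    not-near i (iq<k , k≤iq+t) = r>t (%-near {i = i} iq<k k≤iq+t)
    iq≢k+n : ∀ i → i ≤ suc t → i * q ≢ k + suc n
    iq≢k+n i i≤t iq≡k+n = not-wrap (divides i (sym iq≡k+n) ,
      m+n≤o⇒m≤o∸n k (subst₂ _≤_ iq≡k+n (*-comm (suc t) q) (*-monoˡ-≤ q i≤t)))

proposition4p2 : (q n t k : ℕ) → 2 ≤ q → 1 ≤ t → t < n → 1 ≤ k → k ≤ (n ∸ 1) ⊓ (2 * t) →
    (k ≤ t →
      (q ∣ k → M q n t k ≡ + (q ∸ 1)) × (¬ (q ∣ k) → M q n t k ≡ + q))
    ×
    (t < k →
      (q ∣ k → M q n t k ≡ + (q ∸ 2))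
      × (¬ (q ∣ k) → modℕ k q ≤ t → M q n t k ≡ + (q ∸ 1))
      × (¬ (q ∣ k) → q ∣ (k + n) → k ≤ q * t ∸ n → M q n t k ≡ + (q ∸ 1))
      × (¬ (q ∣ k) → ¬ (modℕ k q ≤ t) → ¬ (q ∣ (k + n) × k ≤ q * t ∸ n) → M q n t k ≡ + q))
proposition4p2 zero           _       _       _ ()        _  _  _   _
proposition4p2 (suc zero)     _       _       _ (s≤s ())  _  _  _   _
proposition4p2 (suc (suc _))  _       zero    _ _         () _  _   _
proposition4p2 (suc (suc _))  zero    (suc _) _ _         _  () _   _
proposition4p2 (suc (suc q')) (suc n) (suc t) k q≥2       _  _  1≤k k≤n⊓2t =
  (λ k≤t → let open Cases k<n 1≤k (⌈/⌉≡1 (suc t) 1≤k k≤t) (s≤s z≤n) in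
     M-multiple , λ q∤k → M-non-multiple q∤k ≤-refl (inj₁ refl)) ,
  (λ t<k → let open Cases k<n 1≤k (⌈/⌉≡2 (suc t) t<k k≤2t) q≥2 in
     M-multiple ,
     (λ q∤k r≤t → M-non-multiple q∤k (s≤s z≤n) (inj₂ (near-multiple q∤k r≤t t<k))) ,
     (λ q∤k q∣k+n k≤qt∸n → M-non-multiple q∤k (s≤s z≤n) (inj₂ (wrap-multiple q∣k+n k≤qt∸n))) ,
     (λ q∤k r>t not-wrap → M-far q∤k r>t not-wrap refl))
  where
  k<n : k < suc n
  k<n = s≤s (≤-trans k≤n⊓2t (m⊓n≤m n (2 * suc t)))
  k≤2t : k ≤ 2 * suc t
  k≤2t = ≤-trans k≤n⊓2t (m⊓n≤n n (2 * suc t))
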